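{- For $n\ge 6$, with $r=\frac{n(n-1)}{2}-1$, the coefficients of $d_n(q)$ satisfy $\frac{A_n(1)}{A_n(2)}<\frac{A_n(2)}{A_n(3)}<\cdots<\frac{A_n(r-2)}{A_n(r-1)}<\frac{A_n(r-1)}{A_n(r)}$.
   Context: $d_n(q)=\sum_{\pi\in D_n}q^{\mathrm{maj}(\pi)}$, where $D_n$ is the set of derangements of $\{1,\dots,n\}$ and $\mathrm{maj}(\pi)=\sum_{i:\pi(i)>\pi(i+1)}i$ is the major index; equivalently $d_1(q)=0$ and $d_n(q)=(1+q+\cdots+q^{n-1})d_{n-1}(q)+(-1)^nq^{\binom n2}$ for $n\ge 2$. $A_n(k)$ denotes the coefficient of $q^k$ in $d_n(q)$. -}

module Defs where

open import Data.Nat as ℕ using (ℕ; zero; suc; _∸_; _≤?_)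
open import Data.Nat.Combinatorics using (_C_)
open import Data.Integer using (ℤ; _+_; _*_; -_; +_; 0ℤ; 1ℤ)
open import Relation.Nullary using (yes; no)

-- A polynomial in q with integer coefficients is represented by its
-- coefficient function  ℕ → ℤ  (coefficient of q^k at k).

-- Coefficient of q^k in (1 + q + ... + q^(m-1)) * c(q):
--   Σ_{j < m, j ≤ k} c (k - j)
qint-mul : ℕ → (ℕ → ℤ) → ℕ → ℤ
qint-mul zero    c k = 0ℤ
qint-mul (suc j) c k with j ≤? k
... | yes _ = qint-mul j c k + c (k ∸ j)
... | no  _ = qint-mul j c k

sgn : ℕ → ℤ
sgn zero          = 1ℤ
sgn (suc zero)    = - 1ℤ
sgn (suc (suc n)) = sgn n

mono : ℕ → ℕ → ℤ
mono e k with e ℕ.≟ k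
... | yes _ = 1ℤ
... | no  _ = 0ℤ

-- A n k = coefficient of q^k in d_n(q), via the recursion
--   d_1(q) = 0,  d_n(q) = [n]_q d_{n-1}(q) + (-1)^n q^(n choose 2)  (n ≥ 2).
-- (d_0 does not occur in the paper; we set it to 0, it is never used.)
A : ℕ → ℕ → ℤ
A zero          k = 0ℤ
A (suc zero)    k = 0ℤ
A (suc (suc m)) k =
  qint-mul (suc (suc m)) (A (suc m)) k + sgn (suc (suc m)) * mono ((suc (suc m)) C 2) k

-- Let c be the coefficient sequence of d_n, of degree N = n C 2. Below the top degree of d_{n+1},
-- its coefficients are the sums W_l of n + 1 consecutive values of c. For such window sums,
-- W_{l+1}² − W_l W_{l+2} is a sum of 2 × 2 minors c_{u+1} c_y − c_u c_{y+1} with u < y, and strict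
-- log-concavity of c makes these minors positive (the ratios c_{u+1} / c_u decrease). Hence
-- positivity of A_n(1), …, A_n(N − 1) and the strict log-concavity claimed by the theorem pass from
-- n to n + 1. The leading coefficient of d_n is 1 for even n and 0 for odd n; the minors involving
-- it are controlled by the next three coefficients, which are q, q (q + 1) and at most (q + 1) q²
-- for n = 2q + 2, and q + 1, (q + 1)² and at most (q + 1) (q² + q + 1) for n = 2q + 3. The
-- induction starts at n = 6, which is checked by evaluation.

module Submission where

open import Defs

module LogConcavity where
  open import Data.Nat as ℕ using (ℕ; zero; suc; z≤n; s≤s; s≤s⁻¹; _∸_)
  import Data.Nat.Properties as ℕₚ
  open import Data.Nat.Combinatorics using (_C_; nC1≡n; nCk+nC[k+1]≡[n+1]C[k+1])
  open import Data.Integer as ℤ using (ℤ; +_; 0ℤ; 1ℤ; _+_; _*_; _-_; -_; _≤_; _<_)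
  import Data.Integer.Properties as ℤₚ
  open import Data.Integer.Tactic.RingSolver using (solve-∀)
  import Data.Nat.Tactic.RingSolver as ℕ-Solver
  open import Data.Empty using (⊥-elim)
  open import Data.Product using (_×_; _,_)
  open import Data.Sum using (_⊎_; inj₁; inj₂)
  open import Function using (_∘_)
  open import Relation.Binary.PropositionalEquality
  open import Relation.Nullary using (yes; no)
  open import Relation.Nullary.Decidable using (toWitness)
  open import Data.Unit using (tt)

  i<j⇒0<j-i : ∀ {i j} → i < j → 0ℤ < j - i
  i<j⇒0<j-i {i} {j} i<j = subst (_< j - i) (ℤₚ.+-inverseʳ i) (ℤₚ.+-monoˡ-< (- i) i<j)

  0<i-j⇒j<i : ∀ {i j} → 0ℤ < i - j → j < i
  0<i-j⇒j<i {i} {j} 0<i-j = subst₂ _<_ (ℤₚ.+-identityˡ j) (cancel i j) (ℤₚ.+-monoˡ-< j 0<i-j)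
    where
    cancel : ∀ i j → i - j + j ≡ i
    cancel = solve-∀

  i*j≥0 : ∀ {i j} → 0ℤ ≤ i → 0ℤ ≤ j → 0ℤ ≤ i * j
  i*j≥0 {i} {j} i≥0 j≥0 =
    subst (_≤ i * j) (ℤₚ.*-zeroʳ i) (ℤₚ.*-monoˡ-≤-nonNeg i {{ℤ.nonNegative i≥0}} j≥0)

  i*j>0 : ∀ {i j} → 0ℤ < i → 0ℤ < j → 0ℤ < i * j
  i*j>0 {i} {j} i>0 j>0 =
    subst (_< i * j) (ℤₚ.*-zeroʳ i) (ℤₚ.*-monoˡ-<-pos i {{ℤ.positive i>0}} j>0)

  i+j≡k⇒i≡k-j : ∀ {i j k} → i + j ≡ k → i ≡ k - j
  i+j≡k⇒i≡k-j {i} {j} i+j≡k = trans (cancel i j) (cong (_- j) i+j≡k)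
    where
    cancel : ∀ i j → i ≡ i + j - j
    cancel = solve-∀

  sumFrom : (ℕ → ℤ) → ℕ → ℕ → ℤ
  sumFrom g a zero    = 0ℤ
  sumFrom g a (suc j) = g a + sumFrom g (suc a) j

  sumFrom-snoc : ∀ g a j → sumFrom g a (suc j) ≡ sumFrom g a j + g (a ℕ.+ j)
  sumFrom-snoc g a zero    = begin
    g a + 0ℤ         ≡⟨ ℤₚ.+-comm (g a) 0ℤ ⟩
    0ℤ + g a         ≡⟨ cong (λ x → 0ℤ + g x) (ℕₚ.+-identityʳ a) ⟨
    0ℤ + g (a ℕ.+ 0) ∎
    where open ≡-Reasoning
  sumFrom-snoc g a (suc j) = begin
    g a + sumFrom g (suc a) (suc j)          ≡⟨ cong (_+_ (g a)) (sumFrom-snoc g (suc a) j) ⟩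
    g a + (S + g (suc a ℕ.+ j))              ≡⟨ ℤₚ.+-assoc (g a) S _ ⟨
    g a + S + g (suc a ℕ.+ j)                ≡⟨ cong (λ x → g a + S + g x) (ℕₚ.+-suc a j) ⟨
    g a + S + g (a ℕ.+ suc j)                ∎
    where
    open ≡-Reasoning
    S = sumFrom g (suc a) j

  sumFrom-vanishing : ∀ g a j → (∀ x → a ℕ.≤ x → g x ≡ 0ℤ) → sumFrom g a j ≡ 0ℤ
  sumFrom-vanishing g a zero    g≡0 = refl
  sumFrom-vanishing g a (suc j) g≡0 =
    cong₂ _+_ (g≡0 a ℕₚ.≤-refl) (sumFrom-vanishing g (suc a) j (λ x a<x → g≡0 x (ℕₚ.<⇒≤ a<x)))

  OnWindow : ℕ → ℕ → (ℕ → Set) → Set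
  OnWindow a j P = ∀ x → a ℕ.≤ x → x ℕ.< a ℕ.+ j → P x

  OnWindow-head : ∀ {a j P} → OnWindow a (suc j) P → P a
  OnWindow-head {a} {j} h = h a ℕₚ.≤-refl (ℕₚ.m<m+n a (s≤s z≤n))

  OnWindow-tail : ∀ {a j P} → OnWindow a (suc j) P → OnWindow (suc a) j P
  OnWindow-tail {a} {j} h x a<x x<1+a+j = h x (ℕₚ.<⇒≤ a<x) (subst (x ℕ.<_) (sym (ℕₚ.+-suc a j)) x<1+a+j)

  sumFrom-nonNeg : ∀ g a j → OnWindow a j (λ x → 0ℤ ≤ g x) → 0ℤ ≤ sumFrom g a j
  sumFrom-nonNeg g a zero    h = ℤₚ.≤-refl
  sumFrom-nonNeg g a (suc j) h = ℤₚ.+-mono-≤ (OnWindow-head h) (sumFrom-nonNeg g (suc a) j (OnWindow-tail h))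

  sumFrom-pos : ∀ g a j → OnWindow a j (λ x → 0ℤ ≤ g x) →
                ∀ x → a ℕ.≤ x → x ℕ.< a ℕ.+ j → 0ℤ < g x → 0ℤ < sumFrom g a j
  sumFrom-pos g a zero    h x a≤x x<a+0 _ =
    ⊥-elim (ℕₚ.<⇒≱ (subst (x ℕ.<_) (ℕₚ.+-identityʳ a) x<a+0) a≤x)
  sumFrom-pos g a (suc j) h x a≤x x<a+j gx>0 with ℕₚ.m≤n⇒m<n∨m≡n a≤x
  ... | inj₂ refl = ℤₚ.<-≤-trans gx>0 (ℤₚ.≤-trans (ℤₚ.≤-reflexive (sym (ℤₚ.+-identityʳ (g x))))
                      (ℤₚ.+-monoʳ-≤ (g x) (sumFrom-nonNeg g (suc a) j (OnWindow-tail h))))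
  ... | inj₁ a<x  = ℤₚ.≤-<-trans (ℤₚ.≤-reflexive (sym (ℤₚ.+-identityˡ 0ℤ)))
                      (ℤₚ.+-mono-≤-< (OnWindow-head h)
                        (sumFrom-pos g (suc a) j (OnWindow-tail h) x a<x (subst (x ℕ.<_) (ℕₚ.+-suc a j) x<a+j) gx>0))

  length≤sumFrom : ∀ g a j → OnWindow a j (λ x → 1ℤ ≤ g x) → + j ≤ sumFrom g a j
  length≤sumFrom g a zero    h = ℤₚ.≤-refl
  length≤sumFrom g a (suc j) h = ℤₚ.+-mono-≤ (OnWindow-head h) (length≤sumFrom g (suc a) j (OnWindow-tail h))

  qint-mul-suc-≤ : ∀ j c k → j ℕ.≤ k → qint-mul (suc j) c k ≡ qint-mul j c k + c (k ∸ j)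
  qint-mul-suc-≤ j c k j≤k with j ℕ.≤? k
  ... | yes _   = refl
  ... | no  j≰k = ⊥-elim (j≰k j≤k)

  qint-mul-nonNeg : ∀ m c k → (∀ x → 0ℤ ≤ c x) → 0ℤ ≤ qint-mul m c k
  qint-mul-nonNeg zero    c k c≥0 = ℤₚ.≤-refl
  qint-mul-nonNeg (suc j) c k c≥0 with j ℕ.≤? k
  ... | yes _ = ℤₚ.+-mono-≤ (qint-mul-nonNeg j c k c≥0) (c≥0 (k ∸ j))
  ... | no  _ = qint-mul-nonNeg j c k c≥0

  qint-mul-vanishing : ∀ m c k → (∀ i → i ℕ.< m → i ℕ.≤ k → c (k ∸ i) ≡ 0ℤ) → qint-mul m c k ≡ 0ℤ
  qint-mul-vanishing zero    c k c≡0 = refl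
  qint-mul-vanishing (suc j) c k c≡0 with j ℕ.≤? k
  ... | yes j≤k = cong₂ _+_ (qint-mul-vanishing j c k (λ i i<j → c≡0 i (ℕₚ.m<n⇒m<1+n i<j))) (c≡0 j ℕₚ.≤-refl j≤k)
  ... | no  _   = qint-mul-vanishing j c k (λ i i<j → c≡0 i (ℕₚ.m<n⇒m<1+n i<j))

  qint-mul-term : ∀ m c k j → (∀ x → 0ℤ ≤ c x) → j ℕ.< m → j ℕ.≤ k → c (k ∸ j) ≤ qint-mul m c k
  qint-mul-term (suc i) c k j c≥0 j<1+i j≤k with ℕₚ.m≤n⇒m<n∨m≡n (s≤s⁻¹ j<1+i)
  ... | inj₂ refl = subst (c (k ∸ j) ≤_) (sym (qint-mul-suc-≤ j c k j≤k))
                      (ℤₚ.≤-trans (ℤₚ.≤-reflexive (sym (ℤₚ.+-identityˡ (c (k ∸ j)))))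
                        (ℤₚ.+-monoˡ-≤ (c (k ∸ j)) (qint-mul-nonNeg j c k c≥0)))
  ... | inj₁ j<i with i ℕ.≤? k
  ...   | yes _ = ℤₚ.≤-trans (ℤₚ.≤-reflexive (sym (ℤₚ.+-identityʳ (c (k ∸ j)))))
                    (ℤₚ.+-mono-≤ (qint-mul-term i c k j c≥0 j<i j≤k) (c≥0 (k ∸ i)))
  ...   | no  _ = qint-mul-term i c k j c≥0 j<i j≤k

  qint-mul≡sumFrom : ∀ n c x → qint-mul (suc n) c (x ℕ.+ n) ≡ sumFrom c x (suc n)
  qint-mul≡sumFrom zero    c x = begin
    qint-mul 1 c (x ℕ.+ 0)       ≡⟨ qint-mul-suc-≤ 0 c (x ℕ.+ 0) z≤n ⟩
    0ℤ + c (x ℕ.+ 0)             ≡⟨ ℤₚ.+-comm 0ℤ (c (x ℕ.+ 0)) ⟩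
    c (x ℕ.+ 0) + 0ℤ             ≡⟨ cong (λ y → c y + 0ℤ) (ℕₚ.+-identityʳ x) ⟩
    c x + 0ℤ                     ∎
    where open ≡-Reasoning
  qint-mul≡sumFrom (suc n) c x = begin
    qint-mul (suc (suc n)) c (x ℕ.+ suc n)
      ≡⟨ qint-mul-suc-≤ (suc n) c _ (ℕₚ.m≤n+m (suc n) x) ⟩
    qint-mul (suc n) c (x ℕ.+ suc n) + c (x ℕ.+ suc n ∸ suc n)
      ≡⟨ cong₂ (λ y z → qint-mul (suc n) c y + c z) (ℕₚ.+-suc x n) (ℕₚ.m+n∸n≡m x (suc n)) ⟩
    qint-mul (suc n) c (suc x ℕ.+ n) + c x                 ≡⟨ cong (_+ c x) (qint-mul≡sumFrom n c (suc x)) ⟩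
    sumFrom c (suc x) (suc n) + c x                        ≡⟨ ℤₚ.+-comm _ (c x) ⟩
    sumFrom c x (suc (suc n))                              ∎
    where open ≡-Reasoning

  shiftBy : ℕ → (ℕ → ℤ) → ℕ → ℤ
  shiftBy m c i with m ℕ.≤? i
  ... | yes _ = c (i ∸ m)
  ... | no  _ = 0ℤ

  shiftBy-+ : ∀ m c x → shiftBy m c (m ℕ.+ x) ≡ c x
  shiftBy-+ m c x with m ℕ.≤? m ℕ.+ x
  ... | yes _   = cong c (ℕₚ.m+n∸m≡n m x)
  ... | no  m≰m+x = ⊥-elim (m≰m+x (ℕₚ.m≤m+n m x))

  shiftBy-< : ∀ m c i → i ℕ.< m → shiftBy m c i ≡ 0ℤ
  shiftBy-< m c i i<m with m ℕ.≤? i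
  ... | yes m≤i = ⊥-elim (ℕₚ.<⇒≱ i<m m≤i)
  ... | no  _   = refl

  shiftBy-nonNeg : ∀ m c → (∀ x → 0ℤ ≤ c x) → ∀ i → 0ℤ ≤ shiftBy m c i
  shiftBy-nonNeg m c c≥0 i with m ℕ.≤? i
  ... | yes _ = c≥0 (i ∸ m)
  ... | no  _ = ℤₚ.≤-refl

  shiftBy-cancelˡ : ∀ d m c i → shiftBy (d ℕ.+ m) c (d ℕ.+ i) ≡ shiftBy m c i
  shiftBy-cancelˡ d m c i with d ℕ.+ m ℕ.≤? d ℕ.+ i | m ℕ.≤? i
  ... | yes _     | yes _   = cong c (ℕₚ.[m+n]∸[m+o]≡n∸o d i m)
  ... | yes d+m≤d+i | no m≰i = ⊥-elim (m≰i (ℕₚ.+-cancelˡ-≤ d m i d+m≤d+i))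
  ... | no d+m≰d+i | yes m≤i = ⊥-elim (d+m≰d+i (ℕₚ.+-monoʳ-≤ d m≤i))
  ... | no _      | no _    = refl

  qint-mul-suc : ∀ j c k → qint-mul (suc j) c k ≡ qint-mul j c k + shiftBy (suc j) c (suc k)
  qint-mul-suc j c k with j ℕ.≤? k | suc j ℕ.≤? suc k
  ... | yes _   | yes _     = refl
  ... | yes j≤k | no 1+j≰1+k = ⊥-elim (1+j≰1+k (s≤s j≤k))
  ... | no j≰k  | yes 1+j≤1+k = ⊥-elim (j≰k (s≤s⁻¹ 1+j≤1+k))
  ... | no _    | no _      = sym (ℤₚ.+-identityʳ _)

  qint-mul≡sumFrom-shiftBy : ∀ m c k → qint-mul m c k ≡ sumFrom (shiftBy m c) (suc k) m
  qint-mul≡sumFrom-shiftBy m c k = shifted 0 m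
    where
    open ≡-Reasoning
    shifted : ∀ d j → qint-mul j c k ≡ sumFrom (shiftBy (d ℕ.+ j) c) (d ℕ.+ suc k) j
    shifted d zero    = refl
    shifted d (suc j) = begin
      qint-mul (suc j) c k                         ≡⟨ qint-mul-suc j c k ⟩
      qint-mul j c k + shiftBy (suc j) c (suc k)   ≡⟨ ℤₚ.+-comm (qint-mul j c k) _ ⟩
      shiftBy (suc j) c (suc k) + qint-mul j c k   ≡⟨ cong₂ _+_ (sym (shiftBy-cancelˡ d (suc j) c (suc k))) rest ⟩
      sumFrom (shiftBy (d ℕ.+ suc j) c) (d ℕ.+ suc k) (suc j) ∎
      where
      rest : qint-mul j c k ≡ sumFrom (shiftBy (d ℕ.+ suc j) c) (suc (d ℕ.+ suc k)) j
      rest = trans (shifted (suc d) j) (cong (λ e → sumFrom (shiftBy e c) (suc (d ℕ.+ suc k)) j) (sym (ℕₚ.+-suc d j)))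

  -- The log-concavity gap of window sums

  module WindowSums (Q : ℕ → ℤ) where

    cross : ℕ → ℕ → ℤ
    cross u y = Q (suc u) * Q y - Q u * Q (suc y)

    window : ℕ → ℕ → ℤ
    window m l = sumFrom Q l m

    gap : ℕ → ℕ → ℤ
    gap m l = window m (suc l) * window m (suc l) - window m l * window m (suc (suc l))

    sumFrom-cross-left : ∀ h b j →
      Q h * sumFrom Q (suc b) j - Q (suc h) * sumFrom Q b j ≡ sumFrom (λ u → cross u h) b j
    sumFrom-cross-left h b zero    = expand (Q h) (Q (suc h))
      where
      expand : ∀ x y → x * 0ℤ - y * 0ℤ ≡ 0ℤ
      expand = solve-∀
    sumFrom-cross-left h b (suc j) =
      trans (expand (Q h) (Q (suc b)) (sumFrom Q (suc (suc b)) j) (Q (suc h)) (Q b) (sumFrom Q (suc b) j))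
            (cong (_+_ (cross b h)) (sumFrom-cross-left h (suc b) j))
      where
      expand : ∀ x y z x′ y′ z′ → x * (y + z) - x′ * (y′ + z′) ≡ (y * x - y′ * x′) + (x * z - x′ * z′)
      expand = solve-∀

    sumFrom-cross-right : ∀ l a j → Q (suc l) * sumFrom Q a j - Q l * sumFrom Q (suc a) j ≡ sumFrom (cross l) a j
    sumFrom-cross-right l a zero    = expand (Q (suc l)) (Q l)
      where
      expand : ∀ x y → x * 0ℤ - y * 0ℤ ≡ 0ℤ
      expand = solve-∀
    sumFrom-cross-right l a (suc j) =
      trans (expand (Q (suc l)) (Q a) (sumFrom Q (suc a) j) (Q l) (Q (suc a)) (sumFrom Q (suc (suc a)) j))
            (cong (_+_ (cross l a)) (sumFrom-cross-right l (suc a) j))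
      where
      expand : ∀ x y z x′ y′ z′ → x * (y + z) - x′ * (y′ + z′) ≡ (x * y - x′ * y′) + (x * z - x′ * z′)
      expand = solve-∀

    gap-as-crosses : ∀ m l → gap m l ≡
      sumFrom (λ u → cross u (l ℕ.+ m)) l m + sumFrom (cross l) (suc l) m - cross l (l ℕ.+ m)
    gap-as-crosses m l = begin
      W₁ * W₁ - W₀ * W₂
        ≡⟨ cong₂ (λ a c → W₁ * W₁ - a * c) first-window last-window ⟩
      W₁ * W₁ - (p₀ + W₁ - r₀) * (W₁ + r₁ - p₁)
        ≡⟨ expand W₁ p₀ p₁ r₀ r₁ ⟩
      (r₀ * W₁ - r₁ * (p₀ + W₁ - r₀)) + (p₁ * W₁ - p₀ * (W₁ + r₁ - p₁)) - (p₁ * r₀ - p₀ * r₁)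
        ≡⟨ cong₂ (λ a c → (r₀ * W₁ - r₁ * a) + (p₁ * W₁ - p₀ * c) - (p₁ * r₀ - p₀ * r₁))
                 first-window last-window ⟨
      (r₀ * W₁ - r₁ * W₀) + (p₁ * W₁ - p₀ * W₂) - (p₁ * r₀ - p₀ * r₁)
        ≡⟨ cong₂ (λ x y → x + y - (p₁ * r₀ - p₀ * r₁))
                 (sumFrom-cross-left (l ℕ.+ m) l m) (sumFrom-cross-right l (suc l) m) ⟩
      sumFrom (λ u → cross u (l ℕ.+ m)) l m + sumFrom (cross l) (suc l) m - cross l (l ℕ.+ m) ∎
      where
      open ≡-Reasoning
      W₀ = window m l
      W₁ = window m (suc l)
      W₂ = window m (suc (suc l))
      p₀ = Q l
      p₁ = Q (suc l)
      r₀ = Q (l ℕ.+ m)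
      r₁ = Q (suc (l ℕ.+ m))
      first-window : W₀ ≡ p₀ + W₁ - r₀
      first-window = i+j≡k⇒i≡k-j (sym (sumFrom-snoc Q l m))
      last-window : W₂ ≡ W₁ + r₁ - p₁
      last-window = i+j≡k⇒i≡k-j (trans (ℤₚ.+-comm W₂ p₁) (sumFrom-snoc Q (suc l) m))
      expand : ∀ w p₀ p₁ r₀ r₁ → w * w - (p₀ + w - r₀) * (w + r₁ - p₁) ≡
               (r₀ * w - r₁ * (p₀ + w - r₀)) + (p₁ * w - p₀ * (w + r₁ - p₁)) - (p₁ * r₀ - p₀ * r₁)
      expand = solve-∀

    gap-as-crosses-without-first : ∀ n l → gap (suc n) l ≡
      sumFrom (λ u → cross u (l ℕ.+ suc n)) (suc l) n + sumFrom (cross l) (suc l) (suc n)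
    gap-as-crosses-without-first n l = trans (gap-as-crosses (suc n) l) (cancel (cross l (l ℕ.+ suc n)) _ _)
      where
      cancel : ∀ z x y → (z + x) + y - z ≡ x + y
      cancel = solve-∀

    gap-as-crosses-without-last : ∀ n l → gap (suc n) l ≡
      sumFrom (λ u → cross u (l ℕ.+ suc n)) l (suc n) + sumFrom (cross l) (suc l) n
    gap-as-crosses-without-last n l = begin
      gap (suc n) l
        ≡⟨ gap-as-crosses (suc n) l ⟩
      X + sumFrom (cross l) (suc l) (suc n) - z
        ≡⟨ cong (λ y → X + y - z) (sumFrom-snoc (cross l) (suc l) n) ⟩
      X + (sumFrom (cross l) (suc l) n + cross l (suc l ℕ.+ n)) - z
        ≡⟨ cong (λ e → X + (sumFrom (cross l) (suc l) n + cross l e) - z) (ℕₚ.+-suc l n) ⟨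
      X + (sumFrom (cross l) (suc l) n + z) - z
        ≡⟨ cancel z X (sumFrom (cross l) (suc l) n) ⟩
      X + sumFrom (cross l) (suc l) n ∎
      where
      open ≡-Reasoning
      X = sumFrom (λ u → cross u (l ℕ.+ suc n)) l (suc n)
      z = cross l (l ℕ.+ suc n)
      cancel : ∀ z x y → x + (y + z) - z ≡ x + y
      cancel = solve-∀

  -- Sequences with a log-concave profile

  record Profile (c : ℕ → ℤ) (T : ℕ) : Set where
    field
      at-zero     : c 0 ≡ 0ℤ
      nonNeg      : ∀ k → 0ℤ ≤ c k
      positive    : ∀ k → 1 ℕ.≤ k → k ℕ.≤ suc (suc T) → 0ℤ < c k
      vanishing   : ∀ k → suc (suc (suc T)) ℕ.< k → c k ≡ 0ℤ
      log-concave : ∀ k → 1 ℕ.≤ k → k ℕ.≤ T → c k * c (suc (suc k)) < c (suc k) * c (suc k)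

  -- The leading coefficient of d_n is 1 for even n, and then log-concavity fails at the top;
  -- these inequalities are what the window argument needs there instead.
  TopCondition : (ℕ → ℤ) → ℕ → ℕ → Set
  TopCondition c T n =
    c (suc (suc (suc T))) ≡ 0ℤ ⊎
    (c (suc (suc (suc T))) ≡ 1ℤ × c (suc T) < c (suc (suc T)) * c (suc (suc T)) + + n ×
     c T ≤ c (suc (suc T)) * c (suc T))

  ratio-chain : ∀ {a b x y z} → 0ℤ ≤ a → 0ℤ ≤ x → 0ℤ < y → a * y < b * x → x * z < y * y → a * z < b * y
  ratio-chain {a} {b} {x} {y} {z} a≥0 x≥0 y>0 ay<bx xz<yy =
    ℤₚ.*-cancelʳ-<-nonNeg x {{ℤ.nonNegative x≥0}} (begin-strict
    a * z * x   ≡⟨ reassoc a z x ⟩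
    a * (x * z) ≤⟨ ℤₚ.*-monoˡ-≤-nonNeg a {{ℤ.nonNegative a≥0}} (ℤₚ.<⇒≤ xz<yy) ⟩
    a * (y * y) ≡⟨ ℤₚ.*-assoc a y y ⟨
    a * y * y   <⟨ ℤₚ.*-monoʳ-<-pos y {{ℤ.positive y>0}} ay<bx ⟩
    b * x * y   ≡⟨ swap b x y ⟩
    b * y * x   ∎)
    where
    open ℤₚ.≤-Reasoning
    reassoc : ∀ a z x → a * z * x ≡ a * (x * z)
    reassoc = solve-∀
    swap : ∀ b x y → b * x * y ≡ b * y * x
    swap = solve-∀

  module ProfileProperties {c : ℕ → ℤ} {T : ℕ} (profile : Profile c T) where
    open Profile profile
    open WindowSums c using (cross)

    cross-adjacent-pos : ∀ u → u ℕ.≤ T → 0ℤ < cross u (suc u)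
    cross-adjacent-pos zero    _   = i<j⇒0<j-i (subst (_< c 1 * c 1) c₀c₂≡0 (i*j>0 c₁>0 c₁>0))
      where
      c₁>0 : 0ℤ < c 1
      c₁>0 = positive 1 ℕₚ.≤-refl (s≤s z≤n)
      c₀c₂≡0 : 0ℤ ≡ c 0 * c 2
      c₀c₂≡0 = sym (trans (cong (_* c 2) at-zero) (ℤₚ.*-zeroˡ (c 2)))
    cross-adjacent-pos (suc u) u<T = i<j⇒0<j-i (log-concave (suc u) (s≤s z≤n) u<T)

    cross-pos : ∀ {u y} → u ℕ.< y → y ℕ.≤ suc T → 0ℤ < cross u y
    cross-pos {u} {suc y} (s≤s u≤y) y<T+2 with ℕₚ.m≤n⇒m<n∨m≡n u≤y
    ... | inj₂ refl = cross-adjacent-pos u (s≤s⁻¹ y<T+2)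
    ... | inj₁ u<y  = i<j⇒0<j-i (ratio-chain {b = c (suc u)} (nonNeg u) (nonNeg y)
                        (positive (suc y) (s≤s z≤n) (ℕₚ.m≤n⇒m≤1+n y<T+2))
                        (0<i-j⇒j<i (cross-pos u<y (ℕₚ.<⇒≤ y<T+2)))
                        (log-concave y (ℕₚ.≤-trans (s≤s z≤n) u<y) (s≤s⁻¹ y<T+2)))

    cross-nonNeg-beyond : ∀ u y → c (suc y) ≡ 0ℤ → 0ℤ ≤ cross u y
    cross-nonNeg-beyond u y c[1+y]≡0 =
      ℤₚ.i≤j⇒0≤j-i (subst (_≤ c (suc u) * c y) c[u]c[1+y]≡0 (i*j≥0 (nonNeg (suc u)) (nonNeg y)))
      where
      c[u]c[1+y]≡0 : 0ℤ ≡ c u * c (suc y)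
      c[u]c[1+y]≡0 = sym (trans (cong (c u *_) c[1+y]≡0) (ℤₚ.*-zeroʳ (c u)))

    qint-mul-pos : ∀ n k → 1 ℕ.≤ k → k ℕ.≤ suc (suc T) ℕ.+ n → 0ℤ < qint-mul (suc n) c k
    qint-mul-pos n k 1≤k k≤T+2+n with k ℕ.≤? suc (suc T)
    ... | yes k≤T+2 = ℤₚ.<-≤-trans (positive k 1≤k k≤T+2) (qint-mul-term (suc n) c k 0 nonNeg (s≤s z≤n) z≤n)
    ... | no  k≰T+2 = ℤₚ.<-≤-trans
                        (subst (λ i → 0ℤ < c i) (sym k∸j≡T+2) (positive (suc (suc T)) (s≤s z≤n) ℕₚ.≤-refl))
                        (qint-mul-term (suc n) c k j nonNeg j<1+n (ℕₚ.m∸n≤m k (suc (suc T))))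
      where
      j = k ∸ suc (suc T)
      k∸j≡T+2 : k ∸ j ≡ suc (suc T)
      k∸j≡T+2 = ℕₚ.m∸[m∸n]≡n (ℕₚ.<⇒≤ (ℕₚ.≰⇒> k≰T+2))
      j<1+n : j ℕ.< suc n
      j<1+n = s≤s (ℕₚ.m≤n+o⇒m∸n≤o k (suc (suc T)) k≤T+2+n)

    cross-nonNeg-top : ∀ {n} → TopCondition c T n → ∀ u → u ℕ.≤ T → 0ℤ ≤ cross u (suc (suc T))
    cross-nonNeg-top (inj₁ c[T+3]≡0) u _ = cross-nonNeg-beyond u _ c[T+3]≡0
    cross-nonNeg-top (inj₂ (c[T+3]≡1 , _ , c[T]≤)) u u≤T =
      ℤₚ.i≤j⇒0≤j-i (subst (_≤ c (suc u) * c (suc (suc T))) (sym c[u]c[T+3]≡c[u])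
                          (c[u]≤ (ℕₚ.m≤n⇒m<n∨m≡n u≤T)))
      where
      c[u]c[T+3]≡c[u] : c u * c (suc (suc (suc T))) ≡ c u
      c[u]c[T+3]≡c[u] = trans (cong (c u *_) c[T+3]≡1) (ℤₚ.*-identityʳ (c u))
      c[u]≤ : u ℕ.< T ⊎ u ≡ T → c u ≤ c (suc u) * c (suc (suc T))
      c[u]≤ (inj₂ refl) = subst (c u ≤_) (ℤₚ.*-comm (c (suc (suc T))) (c (suc T))) c[T]≤
      c[u]≤ (inj₁ u<T)  = ℤₚ.<⇒≤ (ℤₚ.*-cancelʳ-<-nonNeg (c (suc T)) {{ℤ.nonNegative (nonNeg _)}} (begin-strict
        c u * c (suc T)                           <⟨ 0<i-j⇒j<i (cross-pos u<T (ℕₚ.n≤1+n T)) ⟩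
        c (suc u) * c T                           ≤⟨ ℤₚ.*-monoˡ-≤-nonNeg (c (suc u)) {{ℤ.nonNegative (nonNeg _)}} c[T]≤ ⟩
        c (suc u) * (c (suc (suc T)) * c (suc T)) ≡⟨ ℤₚ.*-assoc (c (suc u)) _ _ ⟨
        c (suc u) * c (suc (suc T)) * c (suc T)   ∎))
        where open ℤₚ.≤-Reasoning

    cross-nonNeg : ∀ {n} → TopCondition c T n →
                   ∀ {u y} → u ℕ.< y → u ℕ.≤ T ⊎ c (suc y) ≡ 0ℤ → 0ℤ ≤ cross u y
    cross-nonNeg top {u} {y} u<y (inj₂ c[1+y]≡0) = cross-nonNeg-beyond u y c[1+y]≡0
    cross-nonNeg top {u} {y} u<y (inj₁ u≤T) with y ℕ.≤? suc T
    ... | yes y≤T+1 = ℤₚ.<⇒≤ (cross-pos u<y y≤T+1)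
    ... | no  y≰T+1 with y ℕ.≟ suc (suc T)
    ...   | yes refl    = cross-nonNeg-top top u u≤T
    ...   | no  y≢T+2 =
      cross-nonNeg-beyond u y (vanishing (suc y) (s≤s (ℕₚ.≤∧≢⇒< (ℕₚ.≰⇒> y≰T+1) (y≢T+2 ∘ sym))))

  module PaddedCrosses {c : ℕ → ℤ} {T n : ℕ} (profile : Profile c T) (top : TopCondition c T n) where
    open Profile profile
    open ProfileProperties profile
    open WindowSums c using (cross)

    m : ℕ
    m = suc n

    -- The window of length m of Padded starting at l is c (l − m), …, c (l − 1), with zeros (not c 0)
    -- at negative indices.
    module Padded = WindowSums (shiftBy m c)

    padded-cross-shift : ∀ u y → Padded.cross (m ℕ.+ u) (m ℕ.+ y) ≡ cross u y
    padded-cross-shift u y = cong₂ _-_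
      (cong₂ _*_ (trans (cong (shiftBy m c) (sym (ℕₚ.+-suc m u))) (shiftBy-+ m c (suc u))) (shiftBy-+ m c y))
      (cong₂ _*_ (shiftBy-+ m c u) (trans (cong (shiftBy m c) (sym (ℕₚ.+-suc m y))) (shiftBy-+ m c (suc y))))

    padded-cross-unshift : ∀ {u y} → m ℕ.≤ u → u ℕ.< y → Padded.cross u y ≡ cross (u ∸ m) (y ∸ m)
    padded-cross-unshift {u} {y} m≤u u<y =
      trans (cong₂ Padded.cross (sym (ℕₚ.m+[n∸m]≡n m≤u)) (sym (ℕₚ.m+[n∸m]≡n (ℕₚ.<⇒≤ (ℕₚ.≤-<-trans m≤u u<y)))))
            (padded-cross-shift (u ∸ m) (y ∸ m))

    padded-cross-nonNeg : ∀ {u y} → u ℕ.< y → (m ℕ.≤ u → u ∸ m ℕ.≤ T ⊎ c (suc (y ∸ m)) ≡ 0ℤ) →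
                          0ℤ ≤ Padded.cross u y
    padded-cross-nonNeg {u} {y} u<y h with u ℕ.<? m
    ... | no  u≮m =
      subst (0ℤ ≤_) (sym (padded-cross-unshift m≤u u<y)) (cross-nonNeg top (ℕₚ.∸-monoˡ-< u<y m≤u) (h m≤u))
      where
      m≤u : m ℕ.≤ u
      m≤u = ℕₚ.≮⇒≥ u≮m
    ... | yes u<m =
      ℤₚ.i≤j⇒0≤j-i (subst (_≤ P (suc u) * P y) P[u]P[1+y]≡0 (i*j≥0 (P-nonNeg (suc u)) (P-nonNeg y)))
      where
      P : ℕ → ℤ
      P = shiftBy m c
      P-nonNeg : ∀ i → 0ℤ ≤ P i
      P-nonNeg = shiftBy-nonNeg m c nonNeg
      P[u]P[1+y]≡0 : 0ℤ ≡ P u * P (suc y)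
      P[u]P[1+y]≡0 = sym (trans (cong (_* P (suc y)) (shiftBy-< m c u u<m)) (ℤₚ.*-zeroˡ (P (suc y))))

    padded-cross-pos : ∀ {u y} → m ℕ.≤ u → u ℕ.< y → y ∸ m ℕ.≤ suc T → 0ℤ < Padded.cross u y
    padded-cross-pos m≤u u<y y-m≤T+1 =
      subst (0ℤ <_) (sym (padded-cross-unshift m≤u u<y)) (cross-pos (ℕₚ.∸-monoˡ-< u<y m≤u) y-m≤T+1)

    module _ (n≤T : n ℕ.≤ T) (1≤n : 1 ℕ.≤ n) where

      gap-pos-low : ∀ l → 1 ℕ.≤ l → l ℕ.≤ suc T → 0ℤ < Padded.gap m l
      gap-pos-low l 1≤l l≤T+1 =
        subst (0ℤ <_) (sym (Padded.gap-as-crosses-without-first n l)) (ℤₚ.+-mono-<-≤ X>0 Y≥0)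
        where
        h = l ℕ.+ m
        X-nonNeg : OnWindow (suc l) n (λ u → 0ℤ ≤ Padded.cross u h)
        X-nonNeg u _ u<1+l+n = padded-cross-nonNeg u<h (λ m≤u → inj₁ (s≤s⁻¹ (ℕₚ.≤-trans (u∸m<l m≤u) l≤T+1)))
          where
          u<h : u ℕ.< h
          u<h = subst (u ℕ.<_) (sym (ℕₚ.+-suc l n)) u<1+l+n
          u∸m<l : m ℕ.≤ u → u ∸ m ℕ.< l
          u∸m<l m≤u = subst (u ∸ m ℕ.<_) (ℕₚ.m+n∸n≡m l m) (ℕₚ.∸-monoˡ-< u<h m≤u)
        X>0 : 0ℤ < sumFrom (λ u → Padded.cross u h) (suc l) n
        X>0 = sumFrom-pos _ (suc l) n X-nonNeg (l ℕ.+ n)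
                (subst (ℕ._≤ l ℕ.+ n) (ℕₚ.+-comm l 1) (ℕₚ.+-monoʳ-≤ l 1≤n)) (ℕₚ.n<1+n (l ℕ.+ n))
                (padded-cross-pos (ℕₚ.+-monoˡ-≤ n 1≤l) (ℕₚ.+-monoʳ-< l (ℕₚ.n<1+n n))
                  (subst (ℕ._≤ suc T) (sym (ℕₚ.m+n∸n≡m l m)) l≤T+1))
        l∸m≤T : l ∸ m ℕ.≤ T
        l∸m≤T = ℕₚ.≤-trans (ℕₚ.∸-monoʳ-≤ l (s≤s z≤n)) (ℕₚ.∸-monoˡ-≤ 1 l≤T+1)
        Y≥0 : 0ℤ ≤ sumFrom (Padded.cross l) (suc l) m
        Y≥0 = sumFrom-nonNeg _ (suc l) m (λ y l<y _ → padded-cross-nonNeg l<y (λ _ → inj₁ l∸m≤T))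

      gap-pos-high : ∀ l → suc T ℕ.< l → l ℕ.≤ T ℕ.+ m → c (suc l) ≡ 0ℤ → 0ℤ < Padded.gap m l
      gap-pos-high l T+1<l l≤T+m c[1+l]≡0 =
        subst (0ℤ <_) (sym (Padded.gap-as-crosses-without-last n l)) (ℤₚ.+-mono-≤-< X≥0 Y>0)
        where
        h = l ℕ.+ m
        m≤l : m ℕ.≤ l
        m≤l = ℕₚ.≤-trans (s≤s n≤T) (ℕₚ.<⇒≤ T+1<l)
        l∸m≤T : l ∸ m ℕ.≤ T
        l∸m≤T = ℕₚ.m≤n+o⇒m∸n≤o l m (subst (l ℕ.≤_) (ℕₚ.+-comm T m) l≤T+m)
        c[1+h∸m]≡0 : c (suc (h ∸ m)) ≡ 0ℤ
        c[1+h∸m]≡0 = subst (λ x → c (suc x) ≡ 0ℤ) (sym (ℕₚ.m+n∸n≡m l m)) c[1+l]≡0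
        X≥0 : 0ℤ ≤ sumFrom (λ u → Padded.cross u h) l m
        X≥0 = sumFrom-nonNeg _ l m (λ u _ u<h → padded-cross-nonNeg u<h (λ _ → inj₂ c[1+h∸m]≡0))
        Y-nonNeg : OnWindow (suc l) n (λ y → 0ℤ ≤ Padded.cross l y)
        Y-nonNeg y l<y _ = padded-cross-nonNeg l<y (λ _ → inj₁ l∸m≤T)
        Y>0 : 0ℤ < sumFrom (Padded.cross l) (suc l) n
        Y>0 = sumFrom-pos _ (suc l) n Y-nonNeg (suc l) ℕₚ.≤-refl (ℕₚ.m<m+n (suc l) 1≤n)
                (padded-cross-pos m≤l (ℕₚ.n<1+n l) (subst (ℕ._≤ suc T) (sym (ℕₚ.+-∸-assoc 1 m≤l)) (s≤s l∸m≤T)))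

      -- The minor v = c (T+2)² − c (T+1) may be negative; the n minors in Y are positive integers
      -- and make up for it.
      gap-pos-top : c (suc (suc (suc T))) ≡ 1ℤ → c (suc T) < c (suc (suc T)) * c (suc (suc T)) + + n →
                    0ℤ < Padded.gap m (suc (suc T))
      gap-pos-top c[T+3]≡1 c[T+1]<c[T+2]²+n =
        subst (0ℤ <_) (sym (Padded.gap-as-crosses-without-last n l)) (begin-strict
        0ℤ                    <⟨ 0<v+n ⟩
        v + + n               ≡⟨ cong (_+ + n) (ℤₚ.+-identityˡ v) ⟨
        0ℤ + v + + n          ≤⟨ ℤₚ.+-mono-≤ (ℤₚ.+-monoˡ-≤ v X′≥0) Y≥n ⟩
        X′ + v + Y            ≡⟨ cong (_+ Y) (sumFrom-snoc (λ u → Padded.cross u h) l n) ⟨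
        sumFrom (λ u → Padded.cross u h) l m + Y ∎)
        where
        open ℤₚ.≤-Reasoning
        l = suc (suc T)
        h = l ℕ.+ m
        X′ = sumFrom (λ u → Padded.cross u h) l n
        Y = sumFrom (Padded.cross l) (suc l) n
        v = Padded.cross (l ℕ.+ n) h
        l+n≡m+T+1 : l ℕ.+ n ≡ m ℕ.+ suc T
        l+n≡m+T+1 = cong suc (ℕₚ.+-comm (suc T) n)
        v≡ : v ≡ c l * c l - c (suc T)
        v≡ = begin-equality
          v                                         ≡⟨ cong₂ Padded.cross l+n≡m+T+1 (ℕₚ.+-comm l m) ⟩
          Padded.cross (m ℕ.+ suc T) (m ℕ.+ l)      ≡⟨ padded-cross-shift (suc T) l ⟩
          c l * c l - c (suc T) * c (suc l)         ≡⟨ cong (λ x → c l * c l - c (suc T) * x) c[T+3]≡1 ⟩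
          c l * c l - c (suc T) * 1ℤ                ≡⟨ cong (λ x → c l * c l - x) (ℤₚ.*-identityʳ (c (suc T))) ⟩
          c l * c l - c (suc T)                     ∎
        0<v+n : 0ℤ < v + + n
        0<v+n = subst (0ℤ <_) (trans (regroup (c l * c l) (+ n) (c (suc T))) (cong (_+ + n) (sym v≡)))
                  (i<j⇒0<j-i c[T+1]<c[T+2]²+n)
          where
          regroup : ∀ a k b → a + k - b ≡ a - b + k
          regroup = solve-∀
        X′≥0 : 0ℤ ≤ X′
        X′≥0 = sumFrom-nonNeg _ l n (λ u _ u<l+n →
                 padded-cross-nonNeg (ℕₚ.<-trans u<l+n (ℕₚ.+-monoʳ-< l (ℕₚ.n<1+n n)))
                   (λ _ → inj₁ (s≤s⁻¹ (ℕₚ.m<n+o⇒m∸n<o u m (subst (u ℕ.<_) l+n≡m+T+1 u<l+n)))))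
        m≤l : m ℕ.≤ l
        m≤l = s≤s (ℕₚ.m≤n⇒m≤1+n n≤T)
        Y≥n : + n ≤ Y
        Y≥n = length≤sumFrom _ (suc l) n (λ y l<y y<1+l+n → ℤₚ.i<j⇒suc[i]≤j (padded-cross-pos m≤l l<y
                (s≤s⁻¹ (ℕₚ.m<n+o⇒m∸n<o y m (subst (y ℕ.<_) (cong suc (ℕₚ.+-comm l n)) y<1+l+n)))))

      gap-pos-at-T+2 : TopCondition c T n → suc (suc T) ℕ.≤ T ℕ.+ m → 0ℤ < Padded.gap m (suc (suc T))
      gap-pos-at-T+2 (inj₁ c[T+3]≡0)                 T+2≤T+m = gap-pos-high _ ℕₚ.≤-refl T+2≤T+m c[T+3]≡0
      gap-pos-at-T+2 (inj₂ (c[T+3]≡1 , c[T+1]< , _)) _       = gap-pos-top c[T+3]≡1 c[T+1]<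

      gap-pos : ∀ l → 1 ℕ.≤ l → l ℕ.≤ T ℕ.+ m → 0ℤ < Padded.gap m l
      gap-pos l 1≤l l≤T+m with l ℕ.≤? suc T
      ... | yes l≤T+1 = gap-pos-low l 1≤l l≤T+1
      ... | no  l≰T+1 with l ℕ.≟ suc (suc T)
      ...   | yes refl  = gap-pos-at-T+2 top l≤T+m
      ...   | no  l≢T+2 = gap-pos-high l T+1<l l≤T+m (vanishing (suc l) (s≤s (ℕₚ.≤∧≢⇒< T+1<l (l≢T+2 ∘ sym))))
        where
        T+1<l : suc T ℕ.< l
        T+1<l = ℕₚ.≰⇒> l≰T+1

      qint-mul-log-concave : ∀ k → 1 ℕ.≤ k → k ℕ.≤ T ℕ.+ n →
        qint-mul m c k * qint-mul m c (suc (suc k)) < qint-mul m c (suc k) * qint-mul m c (suc k)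
      qint-mul-log-concave k _ k≤T+n =
        0<i-j⇒j<i (subst (0ℤ <_) gap≡ (gap-pos (suc k) (s≤s z≤n) 1+k≤T+m))
        where
        a = qint-mul m c
        1+k≤T+m : suc k ℕ.≤ T ℕ.+ m
        1+k≤T+m = subst (suc k ℕ.≤_) (sym (ℕₚ.+-suc T n)) (s≤s k≤T+n)
        gap≡ : Padded.gap m (suc k) ≡ a (suc k) * a (suc k) - a k * a (suc (suc k))
        gap≡ = sym (cong₂ (λ x yz → x * x - yz) (qint-mul≡sumFrom-shiftBy m c (suc k))
                 (cong₂ _*_ (qint-mul≡sumFrom-shiftBy m c k) (qint-mul≡sumFrom-shiftBy m c (suc (suc k)))))

  -- The shape of d_n

  evenIndicator : ℕ → ℤ
  evenIndicator zero          = 1ℤ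
  evenIndicator (suc zero)    = 0ℤ
  evenIndicator (suc (suc n)) = evenIndicator n

  evenIndicator-+-sgn : ∀ n → evenIndicator n + sgn (suc n) ≡ evenIndicator (suc n)
  evenIndicator-+-sgn zero          = refl
  evenIndicator-+-sgn (suc zero)    = refl
  evenIndicator-+-sgn (suc (suc n)) = evenIndicator-+-sgn n

  evenIndicator-nonNeg : ∀ n → 0ℤ ≤ evenIndicator n
  evenIndicator-nonNeg zero          = ℤ.+≤+ z≤n
  evenIndicator-nonNeg (suc zero)    = ℤₚ.≤-refl
  evenIndicator-nonNeg (suc (suc n)) = evenIndicator-nonNeg n

  suc-C-2 : ∀ n → suc n C 2 ≡ n C 2 ℕ.+ n
  suc-C-2 n = begin
    suc n C 2           ≡⟨ nCk+nC[k+1]≡[n+1]C[k+1] n 1 ⟨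
    n C 1 ℕ.+ n C 2     ≡⟨ cong (ℕ._+ n C 2) (nC1≡n n) ⟩
    n ℕ.+ n C 2         ≡⟨ ℕₚ.+-comm n (n C 2) ⟩
    n C 2 ℕ.+ n         ∎
    where open ≡-Reasoning

  mono-≢ : ∀ {e k} → e ≢ k → mono e k ≡ 0ℤ
  mono-≢ {e} {k} e≢k with e ℕ.≟ k
  ... | yes e≡k = ⊥-elim (e≢k e≡k)
  ... | no  _   = refl

  mono-refl : ∀ e → mono e e ≡ 1ℤ
  mono-refl e with e ℕ.≟ e
  ... | yes _   = refl
  ... | no  e≢e = ⊥-elim (e≢e refl)

  A-suc-≢ : ∀ n k → suc (suc n) C 2 ≢ k → A (suc (suc n)) k ≡ qint-mul (suc (suc n)) (A (suc n)) k
  A-suc-≢ n k N≢k = begin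
    a + s * mono (suc (suc n) C 2) k ≡⟨ cong (λ x → a + s * x) (mono-≢ N≢k) ⟩
    a + s * 0ℤ                       ≡⟨ cong (_+_ a) (ℤₚ.*-zeroʳ s) ⟩
    a + 0ℤ                           ≡⟨ ℤₚ.+-identityʳ a ⟩
    a                                ∎
    where
    open ≡-Reasoning
    a = qint-mul (suc (suc n)) (A (suc n)) k
    s = sgn (suc (suc n))

  A-suc-top : ∀ n → A (suc (suc n)) (suc (suc n) C 2) ≡
                    qint-mul (suc (suc n)) (A (suc n)) (suc (suc n) C 2) + sgn (suc (suc n))
  A-suc-top n = cong (_+_ (qint-mul (suc (suc n)) (A (suc n)) N)) (trans (cong (s *_) (mono-refl N)) (ℤₚ.*-identityʳ s))
    where
    N = suc (suc n) C 2
    s = sgn (suc (suc n))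

  record Shape (n : ℕ) : Set where
    field
      at-zero   : A n 0 ≡ 0ℤ
      nonNeg    : ∀ k → 0ℤ ≤ A n k
      leading   : A n (n C 2) ≡ evenIndicator n
      vanishing : ∀ k → n C 2 ℕ.< k → A n k ≡ 0ℤ

  shape-suc : ∀ n → Shape (suc n) → Shape (suc (suc n))
  shape-suc n sh = record { at-zero = at-zero′ ; nonNeg = nonNeg′ ; leading = leading′ ; vanishing = vanishing′ }
    where
    open Shape sh
    c : ℕ → ℤ
    c = A (suc n)
    N : ℕ
    N = suc n C 2
    N′≡N+1+n : suc (suc n) C 2 ≡ N ℕ.+ suc n
    N′≡N+1+n = suc-C-2 (suc n)

    at-zero′ : A (suc (suc n)) 0 ≡ 0ℤ
    at-zero′ = trans (A-suc-≢ n 0 N′≢0)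
                     (qint-mul-vanishing (suc (suc n)) c 0 (λ i _ _ → trans (cong c (ℕₚ.0∸n≡0 i)) at-zero))
      where
      N′≢0 : suc (suc n) C 2 ≢ 0
      N′≢0 N′≡0 = ℕₚ.1+n≢0 (trans (sym (ℕₚ.+-suc N n)) (trans (sym N′≡N+1+n) N′≡0))

    leading′ : A (suc (suc n)) (suc (suc n) C 2) ≡ evenIndicator (suc (suc n))
    leading′ = begin
      A (suc (suc n)) (suc (suc n) C 2)                     ≡⟨ A-suc-top n ⟩
      qint-mul (suc (suc n)) c (suc (suc n) C 2) + s        ≡⟨ cong (λ k → qint-mul (suc (suc n)) c k + s) N′≡N+1+n ⟩
      qint-mul (suc (suc n)) c (N ℕ.+ suc n) + s            ≡⟨ cong (_+ s) (qint-mul≡sumFrom (suc n) c N) ⟩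
      c N + sumFrom c (suc N) (suc n) + s
        ≡⟨ cong (λ x → c N + x + s) (sumFrom-vanishing c (suc N) (suc n) vanishing) ⟩
      c N + 0ℤ + s                                          ≡⟨ cong (_+ s) (trans (ℤₚ.+-identityʳ (c N)) leading) ⟩
      evenIndicator (suc n) + s                             ≡⟨ evenIndicator-+-sgn (suc n) ⟩
      evenIndicator (suc (suc n))                           ∎
      where
      open ≡-Reasoning
      s = sgn (suc (suc n))

    vanishing′ : ∀ k → suc (suc n) C 2 ℕ.< k → A (suc (suc n)) k ≡ 0ℤ
    vanishing′ k N′<k = trans (A-suc-≢ n k (ℕₚ.<⇒≢ N′<k)) (qint-mul-vanishing (suc (suc n)) c k c[k∸i]≡0)
      where
      c[k∸i]≡0 : ∀ i → i ℕ.< suc (suc n) → i ℕ.≤ k → c (k ∸ i) ≡ 0ℤ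
      c[k∸i]≡0 i i<n+2 _ = vanishing (k ∸ i) (ℕₚ.m+n≤o⇒m≤o∸n (suc N) (begin
        suc N ℕ.+ i        ≤⟨ ℕₚ.+-monoʳ-≤ (suc N) (s≤s⁻¹ i<n+2) ⟩
        suc N ℕ.+ suc n    ≡⟨ cong suc N′≡N+1+n ⟨
        suc (suc (suc n) C 2) ≤⟨ N′<k ⟩
        k                  ∎))
        where open ℕₚ.≤-Reasoning

    nonNeg′ : ∀ k → 0ℤ ≤ A (suc (suc n)) k
    nonNeg′ k with k ℕ.≟ suc (suc n) C 2
    ... | yes refl = subst (0ℤ ≤_) (sym leading′) (evenIndicator-nonNeg (suc (suc n)))
    ... | no  k≢N′ = subst (0ℤ ≤_) (sym (A-suc-≢ n k (k≢N′ ∘ sym))) (qint-mul-nonNeg (suc (suc n)) c k nonNeg)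

  shape : ∀ n → Shape (suc n)
  shape zero    = record
    { at-zero = refl ; nonNeg = λ _ → ℤₚ.≤-refl ; leading = refl ; vanishing = λ _ _ → refl }
  shape (suc n) = shape-suc n (shape n)

  -- The induction on n

  record Invariant (n : ℕ) : Set where
    field
      T           : ℕ
      degree      : n C 2 ≡ suc (suc (suc T))
      positive    : ∀ k → 1 ℕ.≤ k → k ℕ.≤ suc (suc T) → 0ℤ < A n k
      log-concave : ∀ k → 1 ℕ.≤ k → k ℕ.≤ T → A n k * A n (suc (suc k)) < A n (suc k) * A n (suc k)
      n≤T         : n ℕ.≤ T

  invariant-profile : ∀ {n} (I : Invariant (suc n)) → Profile (A (suc n)) (Invariant.T I)
  invariant-profile {n} I = record
    { at-zero     = at-zero
    ; nonNeg      = nonNeg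
    ; positive    = positive
    ; vanishing   = λ k N<k → vanishing k (subst (ℕ._< k) (sym degree) N<k)
    ; log-concave = log-concave
    }
    where
    open Shape (shape n)
    open Invariant I

  TopValues : ∀ {n} → Invariant n → ℕ → ℕ → ℕ → Set
  TopValues {n} I x y z = A n (suc (suc T)) ≡ + x × A n (suc T) ≡ + y × A n T ≤ + z
    where open Invariant I

  module InvariantStep {n : ℕ} (I : Invariant (3 ℕ.+ n))
                       (top : TopCondition (A (3 ℕ.+ n)) (Invariant.T I) (3 ℕ.+ n)) where
    open Invariant I
    open ProfileProperties (invariant-profile I) using (qint-mul-pos)
    open PaddedCrosses (invariant-profile I) top using (qint-mul-log-concave)

    c : ℕ → ℤ
    c = A (3 ℕ.+ n)

    T′ : ℕ
    T′ = T ℕ.+ (3 ℕ.+ n)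

    degree′ : (4 ℕ.+ n) C 2 ≡ suc (suc (suc T′))
    degree′ = trans (suc-C-2 (3 ℕ.+ n)) (cong (ℕ._+ (3 ℕ.+ n)) degree)

    A≡qint-mul : ∀ k → k ℕ.≤ suc (suc T′) → A (4 ℕ.+ n) k ≡ qint-mul (4 ℕ.+ n) c k
    A≡qint-mul k k≤T′+2 =
      A-suc-≢ (suc (suc n)) k (λ N′≡k → ℕₚ.<-irrefl (trans (sym N′≡k) degree′) (s≤s k≤T′+2))

    log-concave′ : ∀ k → 1 ℕ.≤ k → k ℕ.≤ T′ →
                   A (4 ℕ.+ n) k * A (4 ℕ.+ n) (suc (suc k)) < A (4 ℕ.+ n) (suc k) * A (4 ℕ.+ n) (suc k)
    log-concave′ k 1≤k k≤T′ = subst₂ _<_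
      (sym (cong₂ _*_ (A≡qint-mul k (ℕₚ.m≤n⇒m≤1+n k≤T′+1)) (A≡qint-mul (suc (suc k)) (s≤s (s≤s k≤T′)))))
      (sym (cong₂ _*_ (A≡qint-mul (suc k) (s≤s k≤T′+1)) (A≡qint-mul (suc k) (s≤s k≤T′+1))))
      (qint-mul-log-concave n≤T (s≤s z≤n) k 1≤k k≤T′)
      where
      k≤T′+1 : k ℕ.≤ suc T′
      k≤T′+1 = ℕₚ.m≤n⇒m≤1+n k≤T′

    invariant-suc : Invariant (4 ℕ.+ n)
    invariant-suc = record
      { T           = T′
      ; degree      = degree′
      ; positive    = λ k 1≤k k≤T′+2 →
          subst (0ℤ <_) (sym (A≡qint-mul k k≤T′+2)) (qint-mul-pos (3 ℕ.+ n) k 1≤k k≤T′+2)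
      ; log-concave = log-concave′
      ; n≤T         = ℕₚ.+-monoˡ-≤ (3 ℕ.+ n) (ℕₚ.≤-trans (s≤s z≤n) n≤T)
      }

    top-values-suc : ∀ {e x y z} → c (suc (suc (suc T))) ≡ + e → TopValues I x y z →
                     TopValues invariant-suc (x ℕ.+ e) (y ℕ.+ (x ℕ.+ e)) (z ℕ.+ (y ℕ.+ (x ℕ.+ e)))
    top-values-suc {e} {x} {y} {z} c₃≡e (c₂≡x , c₁≡y , c₀≤z) = a[T′+2]≡ , a[T′+1]≡ , a[T′]≤
      where
      open ≡-Reasoning
      c₀ = c T
      c₁ = c (suc T)
      c₂ = c (suc (suc T))
      c₃ = c (suc (suc (suc T)))
      tail : ℕ → ℤ
      tail = sumFrom c (4 ℕ.+ T)
      tail≡0 : ∀ j → tail j ≡ 0ℤ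
      tail≡0 j = sumFrom-vanishing c _ j (Profile.vanishing (invariant-profile I))
      as-window : ∀ i → i ℕ.≤ suc (suc T) → A (4 ℕ.+ n) (i ℕ.+ (3 ℕ.+ n)) ≡ sumFrom c i (4 ℕ.+ n)
      as-window i i≤T+2 = trans (A≡qint-mul _ (ℕₚ.+-monoˡ-≤ (3 ℕ.+ n) i≤T+2)) (qint-mul≡sumFrom (3 ℕ.+ n) c i)
      c₂+c₃≡ : c₂ + (c₃ + 0ℤ) ≡ + (x ℕ.+ e)
      c₂+c₃≡ = begin
        c₂ + (c₃ + 0ℤ)       ≡⟨ cong₂ (λ u v → u + (v + 0ℤ)) c₂≡x c₃≡e ⟩
        + (x ℕ.+ (e ℕ.+ 0))  ≡⟨ cong (λ k → + (x ℕ.+ k)) (ℕₚ.+-identityʳ e) ⟩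
        + (x ℕ.+ e)          ∎
      a[T′+2]≡ : A (4 ℕ.+ n) (suc (suc T′)) ≡ + (x ℕ.+ e)
      a[T′+2]≡ = begin
        A (4 ℕ.+ n) (suc (suc T′))  ≡⟨ as-window (suc (suc T)) ℕₚ.≤-refl ⟩
        c₂ + (c₃ + tail (2 ℕ.+ n))  ≡⟨ cong (λ t → c₂ + (c₃ + t)) (tail≡0 (2 ℕ.+ n)) ⟩
        c₂ + (c₃ + 0ℤ)              ≡⟨ c₂+c₃≡ ⟩
        + (x ℕ.+ e)                 ∎
      a[T′+1]≡ : A (4 ℕ.+ n) (suc T′) ≡ + (y ℕ.+ (x ℕ.+ e))
      a[T′+1]≡ = begin
        A (4 ℕ.+ n) (suc T′)              ≡⟨ as-window (suc T) (ℕₚ.n≤1+n (suc T)) ⟩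
        c₁ + (c₂ + (c₃ + tail (1 ℕ.+ n))) ≡⟨ cong (λ t → c₁ + (c₂ + (c₃ + t))) (tail≡0 (1 ℕ.+ n)) ⟩
        c₁ + (c₂ + (c₃ + 0ℤ))             ≡⟨ cong₂ _+_ c₁≡y c₂+c₃≡ ⟩
        + (y ℕ.+ (x ℕ.+ e))               ∎
      a[T′]≤ : A (4 ℕ.+ n) T′ ≤ + (z ℕ.+ (y ℕ.+ (x ℕ.+ e)))
      a[T′]≤ = ℤₚ.≤-trans (ℤₚ.≤-reflexive (begin
        A (4 ℕ.+ n) T′                          ≡⟨ as-window T (ℕₚ.m≤n⇒m≤1+n (ℕₚ.n≤1+n T)) ⟩
        c₀ + (c₁ + (c₂ + (c₃ + tail n)))        ≡⟨ cong (λ t → c₀ + (c₁ + (c₂ + (c₃ + t)))) (tail≡0 n) ⟩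
        c₀ + (c₁ + (c₂ + (c₃ + 0ℤ)))            ≡⟨ cong (λ t → c₀ + (c₁ + t)) c₂+c₃≡ ⟩
        c₀ + (c₁ + + (x ℕ.+ e))                 ≡⟨ cong (λ t → c₀ + (t + + (x ℕ.+ e))) c₁≡y ⟩
        c₀ + + (y ℕ.+ (x ℕ.+ e))                ∎))
        (ℤₚ.+-monoˡ-≤ (+ (y ℕ.+ (x ℕ.+ e))) c₀≤z)

  leading-coefficient : ∀ {n} (I : Invariant (suc n)) →
                        A (suc n) (suc (suc (suc (Invariant.T I)))) ≡ evenIndicator (suc n)
  leading-coefficient {n} I = trans (cong (A (suc n)) (sym (Invariant.degree I))) (Shape.leading (shape n))

  TopValues-mono : ∀ {n} {I : Invariant n} {x y z x′ y′ z′} → x ≡ x′ → y ≡ y′ → z ℕ.≤ z′ →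
                   TopValues I x y z → TopValues I x′ y′ z′
  TopValues-mono refl refl z≤z′ (c[T+2]≡x , c[T+1]≡y , c[T]≤z) =
    c[T+2]≡x , c[T+1]≡y , ℤₚ.≤-trans c[T]≤z (ℤ.+≤+ z≤z′)

  top-condition : ∀ {n} (I : Invariant n) {x y z} → TopValues I x y z →
                  A n (suc (suc (suc (Invariant.T I)))) ≡ 1ℤ → y ℕ.< x ℕ.* x ℕ.+ n → z ℕ.≤ x ℕ.* y →
                  TopCondition (A n) (Invariant.T I) n
  top-condition {n} I {x} {y} {z} (c[T+2]≡x , c[T+1]≡y , c[T]≤z) c[T+3]≡1 y<x²+n z≤xy =
    inj₂ (c[T+3]≡1 , lt , le)
    where
    open Invariant I using (T)
    lt : A n (suc T) < A n (suc (suc T)) * A n (suc (suc T)) + + n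
    lt = subst₂ _<_ (sym c[T+1]≡y)
           (trans (cong (_+ + n) (ℤₚ.pos-* x x)) (sym (cong₂ (λ u v → u * v + + n) c[T+2]≡x c[T+2]≡x)))
           (ℤ.+<+ y<x²+n)
    le : A n T ≤ A n (suc (suc T)) * A n (suc T)
    le = ℤₚ.≤-trans c[T]≤z
           (subst (+ z ≤_) (trans (ℤₚ.pos-* x y) (sym (cong₂ _*_ c[T+2]≡x c[T+1]≡y))) (ℤ.+≤+ z≤xy))

  -- Unlike q + q, double (suc q) reduces to suc (suc (double q)), so the successor of an odd stage
  -- index is definitionally an even one.
  double : ℕ → ℕ
  double zero    = zero
  double (suc q) = suc (suc (double q))

  double≡+ : ∀ q → double q ≡ q ℕ.+ q
  double≡+ zero    = refl
  double≡+ (suc q) = cong suc (trans (cong suc (double≡+ q)) (sym (ℕₚ.+-suc q q)))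

  evenIndicator-double : ∀ q → evenIndicator (double q) ≡ 1ℤ
  evenIndicator-double zero    = refl
  evenIndicator-double (suc q) = evenIndicator-double q

  evenIndicator-suc-double : ∀ q → evenIndicator (suc (double q)) ≡ 0ℤ
  evenIndicator-suc-double zero    = refl
  evenIndicator-suc-double (suc q) = evenIndicator-suc-double q

  nEven nOdd : ℕ → ℕ
  nEven q = suc (suc (double q))
  nOdd  q = suc (nEven q)

  EvenTop : ∀ q → Invariant (nEven q) → Set
  EvenTop q I = TopValues I q (q ℕ.* suc q) (suc q ℕ.* q ℕ.* q)

  OddTop : ∀ q → Invariant (nOdd q) → Set
  OddTop q I = TopValues I (suc q) (suc q ℕ.* suc q) (suc q ℕ.* (q ℕ.* q ℕ.+ q ℕ.+ 1))

  data Stage : ℕ → Set where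
    even-stage : ∀ q (I : Invariant (nEven (suc q))) → EvenTop (suc q) I → Stage (nEven (suc q))
    odd-stage  : ∀ q (I : Invariant (nOdd (suc q))) → OddTop (suc q) I → Stage (nOdd (suc q))

  stage-invariant : ∀ {n} → Stage n → Invariant n
  stage-invariant (even-stage _ I _) = I
  stage-invariant (odd-stage  _ I _) = I

  odd-stage-after : ∀ q (I : Invariant (nEven (suc q))) → EvenTop (suc q) I → Stage (nOdd (suc q))
  odd-stage-after q I values = odd-stage q invariant-suc
    (TopValues-mono {I = invariant-suc} (ℕₚ.+-comm (suc q) 1) (y′≡ q) (ℕₚ.≤-reflexive (z′≡ q))
      (top-values-suc c[N]≡1 values))
    where
    c[N]≡1 : A (nEven (suc q)) (suc (suc (suc (Invariant.T I)))) ≡ 1ℤ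
    c[N]≡1 = trans (leading-coefficient I) (evenIndicator-double (suc q))
    y<x²+n : suc q ℕ.* suc (suc q) ℕ.< suc q ℕ.* suc q ℕ.+ nEven (suc q)
    y<x²+n = subst (suc q ℕ.* suc (suc q) ℕ.<_)
               (trans (expand q) (cong (λ d → suc q ℕ.* suc q ℕ.+ suc (suc d)) (sym (double≡+ (suc q)))))
               (ℕₚ.m<m+n (suc q ℕ.* suc (suc q)) (s≤s z≤n))
      where
      expand : ∀ q → suc q ℕ.* suc (suc q) ℕ.+ suc (suc (suc q)) ≡
                     suc q ℕ.* suc q ℕ.+ suc (suc (suc q ℕ.+ suc q))
      expand = ℕ-Solver.solve-∀
    z≡xy : ∀ q → suc (suc q) ℕ.* suc q ℕ.* suc q ≡ suc q ℕ.* (suc q ℕ.* suc (suc q))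
    z≡xy = ℕ-Solver.solve-∀
    open InvariantStep I (top-condition I values c[N]≡1 y<x²+n (ℕₚ.≤-reflexive (z≡xy q)))
    y′≡ : ∀ q → suc q ℕ.* suc (suc q) ℕ.+ (suc q ℕ.+ 1) ≡ suc (suc q) ℕ.* suc (suc q)
    y′≡ = ℕ-Solver.solve-∀
    z′≡ : ∀ q → suc (suc q) ℕ.* suc q ℕ.* suc q ℕ.+ (suc q ℕ.* suc (suc q) ℕ.+ (suc q ℕ.+ 1)) ≡
                suc (suc q) ℕ.* (suc q ℕ.* suc q ℕ.+ suc q ℕ.+ 1)
    z′≡ = ℕ-Solver.solve-∀

  even-stage-after : ∀ q (I : Invariant (nOdd (suc q))) → OddTop (suc q) I → Stage (nEven (suc (suc q)))
  even-stage-after q I values = even-stage (suc q) invariant-suc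
    (TopValues-mono {I = invariant-suc} (ℕₚ.+-identityʳ (suc (suc q))) (y′≡ q) z′≤ (top-values-suc c[N]≡0 values))
    where
    c[N]≡0 : A (nOdd (suc q)) (suc (suc (suc (Invariant.T I)))) ≡ 0ℤ
    c[N]≡0 = trans (leading-coefficient I) (evenIndicator-suc-double (suc q))
    open InvariantStep I (inj₁ c[N]≡0)
    y′≡ : ∀ q → suc (suc q) ℕ.* suc (suc q) ℕ.+ (suc (suc q) ℕ.+ 0) ≡ suc (suc q) ℕ.* suc (suc (suc q))
    y′≡ = ℕ-Solver.solve-∀
    z′ = suc (suc q) ℕ.* (suc q ℕ.* suc q ℕ.+ suc q ℕ.+ 1) ℕ.+ (suc (suc q) ℕ.* suc (suc q) ℕ.+ (suc (suc q) ℕ.+ 0))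
    z′≤ : z′ ℕ.≤ suc (suc (suc q)) ℕ.* suc (suc q) ℕ.* suc (suc q)
    z′≤ = subst (z′ ℕ.≤_) (sym (expand q)) (ℕₚ.m≤m+n z′ (suc (suc q) ℕ.* q))
      where
      expand : ∀ q → suc (suc (suc q)) ℕ.* suc (suc q) ℕ.* suc (suc q) ≡
                     suc (suc q) ℕ.* (suc q ℕ.* suc q ℕ.+ suc q ℕ.+ 1) ℕ.+
                     (suc (suc q) ℕ.* suc (suc q) ℕ.+ (suc (suc q) ℕ.+ 0)) ℕ.+ suc (suc q) ℕ.* q
      expand = ℕ-Solver.solve-∀

  stage-suc : ∀ {n} → Stage n → Stage (suc n)
  stage-suc (even-stage q I values) = odd-stage-after q I values
  stage-suc (odd-stage  q I values) = even-stage-after q I values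

  invariant₆ : Invariant 6
  invariant₆ = record
    { T           = 12
    ; degree      = refl
    ; positive    = positive₆
    ; log-concave = log-concave₆
    ; n≤T         = ℕₚ.m≤m+n 6 6
    }
    where
    positive₆ : ∀ k → 1 ℕ.≤ k → k ℕ.≤ 14 → 0ℤ < A 6 k
    positive₆ (suc j) _ j<14 = toWitness {a? = ℕₚ.allUpTo? (λ j → 0ℤ ℤₚ.<? A 6 (suc j)) 14} tt j<14
    log-concave₆ : ∀ k → 1 ℕ.≤ k → k ℕ.≤ 12 → A 6 k * A 6 (suc (suc k)) < A 6 (suc k) * A 6 (suc k)
    log-concave₆ (suc j) _ j<12 =
      toWitness {a? = ℕₚ.allUpTo? (λ j → A 6 (1 ℕ.+ j) * A 6 (3 ℕ.+ j) ℤₚ.<? A 6 (2 ℕ.+ j) * A 6 (2 ℕ.+ j)) 12}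
        tt j<12

  stage : ∀ t → Stage (6 ℕ.+ t)
  stage zero    = even-stage 1 invariant₆ (refl , refl , toWitness {a? = A 6 12 ℤₚ.≤? + 12} tt)
  stage (suc t) = stage-suc (stage t)

  invariant : ∀ n → 6 ℕ.≤ n → Invariant n
  invariant n 6≤n = subst Invariant (ℕₚ.m+[n∸m]≡n 6≤n) (stage-invariant (stage (n ∸ 6)))

open LogConcavity using (module Invariant; invariant)
open import Data.Nat using (ℕ; _≤_; _∸_; suc)
open import Data.Nat.Combinatorics using (_C_)
open import Data.Integer using (_*_; _<_; +_)
open import Data.Product using (_×_; _,_)
open import Data.Nat.Properties using (≤-pred)
open import Relation.Binary.PropositionalEquality using (_≡_; cong; subst)

mainTheorem4 : (n : ℕ) → 6 ≤ n →
    let r = (n C 2) ∸ 1 in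
    ((k : ℕ) → 1 ≤ k → k ≤ r → + 0 < A n k)
    × ((k : ℕ) → 1 ≤ k → suc (suc k) ≤ r →
        A n k * A n (suc (suc k)) < A n (suc k) * A n (suc k))
mainTheorem4 n 6≤n =
  (λ k 1≤k k≤r → positive k 1≤k (subst (k ≤_) r≡T+2 k≤r)) ,
  (λ k 1≤k k+2≤r → log-concave k 1≤k (≤-pred (≤-pred (subst (suc (suc k) ≤_) r≡T+2 k+2≤r))))
  where
  open Invariant (invariant n 6≤n)
  r≡T+2 : n C 2 ∸ 1 ≡ suc (suc T)
  r≡T+2 = cong (_∸ 1) degree
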